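{- Let $r$ be a positive integer. (i) For every integer $c$ with $0 \le c \le \frac{r^2}{2} - 5r^{3/2}$, we have $c\in\mathsf{spec}(r)$, i.e. there exists an $r$-regular graph in which the open neighbourhood of every vertex induces exactly $c$ edges. (ii) If $k$ is a positive integer and $r \ge 3k$, then $\binom{r}{2}-k\notin\mathsf{spec}(r)$.
   Context: All graphs are finite and simple. For a vertex $v$, $N(v)$ denotes its open neighbourhood and $e(v)$ the number of edges of the subgraph induced by $N(v)$. An $(r,c)$-constant graph is an $r$-regular graph in which $e(v)=c$ for every vertex $v$. For a positive integer $r$, $\mathsf{spec}(r)$ is the set of integers $c$ with $0\le c\le\binom r2$ for which an $(r,c)$-constant graph exists. -}

module Defs where

open import Data.Nat using (ℕ; zero; suc; _+_; _*_; _∸_; _^_; _≤_; _<_)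
open import Data.Bool using (Bool; true; false; _∧_)
open import Data.Fin using (Fin; toℕ)
open import Data.List using (List; length; filter; allFin; concatMap; map)
open import Data.Product using (Σ; _×_; _,_)
open import Relation.Binary.PropositionalEquality using (_≡_)
open import Relation.Nullary.Decidable using (does)
open import Data.Bool.Properties using (T?)
open import Data.Bool using (T)
open import Data.Fin using (_<?_)

record Graph (n : ℕ) : Set where
  field
    adj   : Fin n → Fin n → Bool
    sym   : ∀ i j → adj i j ≡ adj j i
    irrefl : ∀ i → adj i i ≡ false
open Graph public

degree : ∀ {n} → Graph n → Fin n → ℕ
degree {n} G v = length (filter (λ j → T? (adj G v j)) (allFin n))

pairs : ∀ n → List (Fin n × Fin n)
pairs n = concatMap (λ a → map (λ b → a , b) (allFin n)) (allFin n)

eN : ∀ {n} → Graph n → Fin n → ℕ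
eN {n} G v = length (filter P? (pairs n))
  where
  P? = λ (p : Fin n × Fin n) → let (a , b) = p in
       T? ((does (a <? b) ∧ adj G v a) ∧ (adj G v b ∧ adj G a b))

Regular : ∀ {n} → Graph n → ℕ → Set
Regular G r = ∀ v → degree G v ≡ r

-- (r,c)-constant graph: r-regular, e(v) = c for all v.
-- Graphs are nonempty (at least one vertex), per the usual convention.
IsConstant : ∀ {n} → Graph n → ℕ → ℕ → Set
IsConstant G r c = Regular G r × (∀ v → eN G v ≡ c)

-- c ∈ spec(r)  (the bound c ≤ binom r 2 is stated separately where needed)
InSpec : ℕ → ℕ → Set
InSpec r c = Σ ℕ λ n → Σ (Graph (suc n)) λ G → IsConstant G r c

{-# OPTIONS --safe #-}
module Submission where

-- (i) K_{m+1} is (m, C(m,2))-constant, and degrees and neighbourhood edge counts add under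
-- the Cartesian product, because every triangle of G □ H lies in a single G- or H-fibre.
-- Write c = C(m,2) + C(a,2) + b greedily, with b < a and C(a,2) + b < m. Then
-- K_{m+1} □ K_{a+1} □ K_3^b □ K_2^p is (m + a + 2b + p, c)-constant, and the bound on c
-- forces m + a + 2b ≤ r, so p = r − m − a − 2b pads the degree up to r.
--
-- (ii) In an r-regular graph, Σ_{u ∈ N(v)} |N(v) ∖ N[u]| = r(r − 1) − 2e(v), which is 2k
-- when e(v) = C(r,2) − k; so at least r − 2k neighbours u of v are full (N(v) ⊆ N[u]).
-- Some neighbour w is not full, and since |N(x) ∖ N[u]| is symmetric in a regular graph,
-- w has a neighbour t ∉ N[v]. Every full vertex is adjacent to w but not to t, so the sum
-- for w collects at least #full + 1 at t, 1 at v and 1 at each full vertex. Hence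
-- 2 #full + 2 ≤ 2k and r ≤ #full + 2k < 3k.

open import Defs renaming (sym to adj-sym; irrefl to adj-irrefl)
open import Data.Bool using (Bool; true; false; _∧_; _∨_; not; T)
open import Data.Bool.Properties using (T?)
open import Data.Empty using (⊥; ⊥-elim)
open import Data.Fin using (Fin; zero; suc; _<?_; _≟_; combine; remQuot; _↑ˡ_; _↑ʳ_)
open import Data.Fin.Properties using (<-cmp; <⇒≢; remQuot-combine)
open import Data.List using (List; length; filter; allFin; concatMap; map; tabulate)
open import Data.List.Properties using (length-++; filter-++; map-tabulate)
open import Data.Nat using (ℕ; zero; suc; _+_; _*_; _∸_; _^_; _≤_; _≰_; _<_; z≤n; s≤s; s≤s⁻¹; _≡ᵇ_; >-nonZero)
  renaming (_<?_ to _<ℕ?_; _≤?_ to _≤ℕ?_)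
open import Data.Nat.Combinatorics using (_C_; nC1≡n; nCk+nC[k+1]≡[n+1]C[k+1])
open import Data.Nat.Properties hiding (_≟_; _<?_; <-cmp; <⇒≢)
open import Algebra.Properties.Semiring.Sum +-*-semiring
  using (sum; sum-syntax; ∑-distrib-+; ∑-comm; sum-cong-≗; *-distribˡ-sum)
open import Algebra.Properties.CommutativeSemigroup *-commutativeSemigroup using (x∙yz≈y∙xz)
open import Data.Nat.Tactic.RingSolver using (solve-∀)
open import Data.Product using (Σ; ∃-syntax; _×_; _,_; proj₁; proj₂)
open import Function using (_∘_; id)
open import Relation.Binary.Definitions using (tri<; tri≈; tri>)
open import Relation.Binary.PropositionalEquality
open import Relation.Nullary using (¬_; Dec; yes; no; contradiction)
open import Relation.Nullary.Decidable using (does; dec-true; dec-false)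

-- Indicators and finite sums

𝟙 : Bool → ℕ
𝟙 true  = 1
𝟙 false = 0

𝟙-∧ : ∀ x y → 𝟙 (x ∧ y) ≡ 𝟙 x * 𝟙 y
𝟙-∧ true  y = sym (+-identityʳ (𝟙 y))
𝟙-∧ false y = refl

𝟙*𝟙 : ∀ x → 𝟙 x * 𝟙 x ≡ 𝟙 x
𝟙*𝟙 true  = refl
𝟙*𝟙 false = refl

𝟙*-pos : ∀ x {m} → 0 < 𝟙 x * m → x ≡ true × 0 < m
𝟙*-pos true {m} p = refl , subst (0 <_) (+-identityʳ m) p

𝟙>0 : ∀ {x} → 0 < 𝟙 x → x ≡ true
𝟙>0 {true} _ = refl

1≤𝟙*𝟙 : ∀ {x y} → x ≡ true → y ≡ true → 1 ≤ 𝟙 x * 𝟙 y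
1≤𝟙*𝟙 refl refl = ≤-refl

δ : ∀ {n} → Fin n → Fin n → ℕ
δ i j = 𝟙 (does (i ≟ j))

δ-refl : ∀ {n} (i : Fin n) → δ i i ≡ 1
δ-refl i = cong 𝟙 (dec-true (i ≟ i) refl)

δ-≢ : ∀ {n} {i j : Fin n} → i ≢ j → δ i j ≡ 0
δ-≢ {i = i} {j} i≢j = cong 𝟙 (dec-false (i ≟ j) i≢j)

does-≟-sym : ∀ {n} (i j : Fin n) → does (i ≟ j) ≡ does (j ≟ i)
does-≟-sym i j with i ≟ j
... | yes refl = sym (dec-true (i ≟ i) refl)
... | no i≢j   = sym (dec-false (j ≟ i) (i≢j ∘ sym))

δ-sym : ∀ {n} (i j : Fin n) → δ i j ≡ δ j i
δ-sym i j = cong 𝟙 (does-≟-sym i j)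

∑-mono-≤ : ∀ {n} {f g : Fin n → ℕ} → (∀ i → f i ≤ g i) → ∑[ i < n ] f i ≤ ∑[ i < n ] g i
∑-mono-≤ {zero}  _   = z≤n
∑-mono-≤ {suc n} f≤g = +-mono-≤ (f≤g zero) (∑-mono-≤ (f≤g ∘ suc))

∑-const : ∀ n k → ∑[ i < n ] k ≡ n * k
∑-const zero    k = refl
∑-const (suc n) k = cong (k +_) (∑-const n k)

∑-zero : ∀ {n} {f : Fin n → ℕ} → (∀ i → f i ≡ 0) → ∑[ i < n ] f i ≡ 0
∑-zero {n} f≡0 = trans (sum-cong-≗ f≡0) (trans (∑-const n 0) (*-zeroʳ n))

∑-δ : ∀ {n} (i : Fin n) (f : Fin n → ℕ) → ∑[ j < n ] (δ i j * f j) ≡ f i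
∑-δ {suc n} zero    f = trans (cong₂ _+_ (*-identityˡ (f zero)) (∑-zero {n} {λ j → 0 * f (suc j)} λ _ → refl))
                                (+-identityʳ (f zero))
∑-δ {suc n} (suc i) f = ∑-δ i (f ∘ suc)

∑-δ-count : ∀ {n} (i : Fin n) → ∑[ j < n ] δ i j ≡ 1
∑-δ-count i = trans (sum-cong-≗ (λ j → sym (*-identityʳ (δ i j)))) (∑-δ i (λ _ → 1))

term≤∑ : ∀ {n} (f : Fin n → ℕ) i → f i ≤ ∑[ j < n ] f j
term≤∑ f zero    = m≤m+n (f zero) _
term≤∑ f (suc i) = ≤-trans (term≤∑ (f ∘ suc) i) (m≤n+m _ (f zero))

∑>0⇒∃>0 : ∀ {n} (f : Fin n → ℕ) → 0 < ∑[ i < n ] f i → ∃[ i ] 0 < f i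
∑>0⇒∃>0 {suc n} f ∑f>0 with f zero in eq
... | suc _ = zero , subst (0 <_) (sym eq) (s≤s z≤n)
... | zero with i , fi>0 ← ∑>0⇒∃>0 (f ∘ suc) ∑f>0 = suc i , fi>0

∑-points+subset≤∑ : ∀ {n} (f : Fin n → ℕ) (P : Fin n → Bool) {i j} →
  i ≢ j → P i ≡ false → P j ≡ false →
  f i + f j + ∑[ u < n ] (𝟙 (P u) * f u) ≤ ∑[ u < n ] f u
∑-points+subset≤∑ {n} f P {i} {j} i≢j Pi Pj = begin
  f i + f j + ∑[ u < n ] (𝟙 (P u) * f u)
    ≡⟨ cong₂ (λ x y → x + y + ∑[ u < n ] (𝟙 (P u) * f u)) (∑-δ i f) (∑-δ j f) ⟨
  ∑[ u < n ] (δ i u * f u) + ∑[ u < n ] (δ j u * f u) + ∑[ u < n ] (𝟙 (P u) * f u)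
    ≡⟨ cong (_+ ∑[ u < n ] (𝟙 (P u) * f u)) (∑-distrib-+ (λ u → δ i u * f u) (λ u → δ j u * f u)) ⟨
  ∑[ u < n ] (δ i u * f u + δ j u * f u) + ∑[ u < n ] (𝟙 (P u) * f u)
    ≡⟨ ∑-distrib-+ (λ u → δ i u * f u + δ j u * f u) (λ u → 𝟙 (P u) * f u) ⟨
  ∑[ u < n ] (δ i u * f u + δ j u * f u + 𝟙 (P u) * f u)
    ≡⟨ sum-cong-≗ (λ u → distribute (δ i u) (δ j u) (𝟙 (P u)) (f u)) ⟩
  ∑[ u < n ] ((δ i u + δ j u + 𝟙 (P u)) * f u)
    ≤⟨ ∑-mono-≤ (λ u → *-monoˡ-≤ (f u) (disjoint u)) ⟩
  ∑[ u < n ] (1 * f u)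
    ≡⟨ sum-cong-≗ (λ u → *-identityˡ (f u)) ⟩
  ∑[ u < n ] f u ∎
  where
  open ≤-Reasoning
  distribute : ∀ a b c x → a * x + b * x + c * x ≡ (a + b + c) * x
  distribute = solve-∀
  𝟙≤1 : ∀ b → 𝟙 b ≤ 1
  𝟙≤1 true  = ≤-refl
  𝟙≤1 false = z≤n
  disjoint : ∀ u → δ i u + δ j u + 𝟙 (P u) ≤ 1
  disjoint u with i ≟ u | j ≟ u
  ... | yes refl | yes refl = contradiction refl i≢j
  ... | yes refl | no _     rewrite Pi = ≤-refl
  ... | no _     | yes refl rewrite Pj = ≤-refl
  ... | no _     | no _     = 𝟙≤1 (P u)

∑𝟙≤∑𝟙* : ∀ {n} (P : Fin n → Bool) (f : Fin n → ℕ) → (∀ u → P u ≡ true → 1 ≤ f u) →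
  ∑[ u < n ] 𝟙 (P u) ≤ ∑[ u < n ] (𝟙 (P u) * f u)
∑𝟙≤∑𝟙* P f f≥1 = ∑-mono-≤ pointwise
  where
  pointwise : ∀ u → 𝟙 (P u) ≤ 𝟙 (P u) * f u
  pointwise u with P u in Pu
  ... | false = z≤n
  ... | true  = ≤-trans (f≥1 u Pu) (≤-reflexive (sym (+-identityʳ (f u))))

∑-↑ : ∀ m n (f : Fin (m + n) → ℕ) →
      ∑[ i < m + n ] f i ≡ ∑[ i < m ] f (i ↑ˡ n) + ∑[ j < n ] f (m ↑ʳ j)
∑-↑ zero    n f = refl
∑-↑ (suc m) n f = trans (cong (f zero +_) (∑-↑ m n (f ∘ suc))) (sym (+-assoc (f zero) _ _))

∑-remQuot : ∀ m n (f : Fin m × Fin n → ℕ) →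
            ∑[ k < m * n ] f (remQuot {m} n k) ≡ ∑[ i < m ] ∑[ j < n ] f (i , j)
∑-remQuot m n f = trans (∑-combine m (f ∘ remQuot n))
  (sum-cong-≗ λ i → sum-cong-≗ λ j → cong f (remQuot-combine i j))
  where
  ∑-combine : ∀ m (g : Fin (m * n) → ℕ) → ∑[ k < m * n ] g k ≡ ∑[ i < m ] ∑[ j < n ] g (combine i j)
  ∑-combine zero    g = refl
  ∑-combine (suc m) g =
    trans (∑-↑ n (m * n) g) (cong (∑[ j < n ] g (j ↑ˡ m * n) +_) (∑-combine m (λ k → g (n ↑ʳ k))))

∑∑-distrib-+ : ∀ {m n} (f g : Fin m → Fin n → ℕ) →
  ∑[ i < m ] ∑[ j < n ] (f i j + g i j) ≡ ∑[ i < m ] ∑[ j < n ] f i j + ∑[ i < m ] ∑[ j < n ] g i j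
∑∑-distrib-+ {n = n} f g = trans (sum-cong-≗ λ i → ∑-distrib-+ (f i) (g i))
  (∑-distrib-+ (λ i → ∑[ j < n ] f i j) (λ i → ∑[ j < n ] g i j))

∑∑∑∑-distrib-+ : ∀ {a b c d} (f g : Fin a → Fin b → Fin c → Fin d → ℕ) →
  ∑[ i < a ] ∑[ j < b ] ∑[ k < c ] ∑[ l < d ] (f i j k l + g i j k l)
    ≡ ∑[ i < a ] ∑[ j < b ] ∑[ k < c ] ∑[ l < d ] f i j k l
      + ∑[ i < a ] ∑[ j < b ] ∑[ k < c ] ∑[ l < d ] g i j k l
∑∑∑∑-distrib-+ {c = c} {d} f g =
  trans (sum-cong-≗ λ i → sum-cong-≗ λ j → ∑∑-distrib-+ (f i j) (g i j))
        (∑∑-distrib-+ (λ i j → ∑[ k < c ] ∑[ l < d ] f i j k l) (λ i j → ∑[ k < c ] ∑[ l < d ] g i j k l))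

∑∑-*ˡ : ∀ {m n} c (f : Fin m → Fin n → ℕ) →
  ∑[ i < m ] ∑[ j < n ] (c * f i j) ≡ c * ∑[ i < m ] ∑[ j < n ] f i j
∑∑-*ˡ {n = n} c f = trans (sum-cong-≗ λ i → sym (*-distribˡ-sum c (f i)))
                          (sym (*-distribˡ-sum c (λ i → ∑[ j < n ] f i j)))

∑∑-*ʳ : ∀ {m n} c (f : Fin m → Fin n → ℕ) →
  ∑[ i < m ] ∑[ j < n ] (f i j * c) ≡ ∑[ i < m ] ∑[ j < n ] f i j * c
∑∑-*ʳ {n = n} c f = trans (sum-cong-≗ λ i → sum-cong-≗ λ j → *-comm (f i j) c)
                          (trans (∑∑-*ˡ c f) (*-comm c _))

∑∑-*-∑∑ : ∀ {a b c d} (f : Fin a → Fin b → ℕ) (g : Fin c → Fin d → ℕ) →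
  ∑[ i < a ] ∑[ j < b ] ∑[ k < c ] ∑[ l < d ] (f i j * g k l)
    ≡ ∑[ i < a ] ∑[ j < b ] f i j * ∑[ k < c ] ∑[ l < d ] g k l
∑∑-*-∑∑ {c = c} {d} f g = trans (sum-cong-≗ λ i → sum-cong-≗ λ j → ∑∑-*ˡ (f i j) g)
                                (∑∑-*ʳ (∑[ k < c ] ∑[ l < d ] g k l) f)

lt : ∀ {n} → Fin n → Fin n → ℕ
lt i j = 𝟙 (does (i <? j))

lt+lt+δ : ∀ {n} (i j : Fin n) → lt i j + lt j i + δ i j ≡ 1
lt+lt+δ i j with <-cmp i j
... | tri< i<j _ j≮i rewrite dec-true (i <? j) i<j | dec-false (j <? i) j≮i | δ-≢ (<⇒≢ i<j) = refl
... | tri> i≮j _ j<i rewrite dec-false (i <? j) i≮j | dec-true (j <? i) j<i | δ-≢ (<⇒≢ j<i ∘ sym) = refl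
... | tri≈ i≮j refl _ rewrite dec-false (i <? i) i≮j | δ-refl i = refl

2*∑∑<≡∑∑ : ∀ {n} (f : Fin n → Fin n → ℕ) → (∀ i j → f i j ≡ f j i) → (∀ i → f i i ≡ 0) →
  2 * ∑[ i < n ] ∑[ j < n ] (lt i j * f i j) ≡ ∑[ i < n ] ∑[ j < n ] f i j
2*∑∑<≡∑∑ {n} f f-sym f-diag = sym (begin
  ∑[ i < n ] ∑[ j < n ] f i j
    ≡⟨ sum-cong-≗ (λ i → sum-cong-≗ λ j → split i j) ⟩
  ∑[ i < n ] ∑[ j < n ] (lt i j * f i j + lt j i * f i j + δ i j * f i j)
    ≡⟨ ∑∑-distrib-+ (λ i j → lt i j * f i j + lt j i * f i j) (λ i j → δ i j * f i j) ⟩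
  ∑[ i < n ] ∑[ j < n ] (lt i j * f i j + lt j i * f i j) + ∑[ i < n ] ∑[ j < n ] (δ i j * f i j)
    ≡⟨ cong₂ _+_ (∑∑-distrib-+ (λ i j → lt i j * f i j) (λ i j → lt j i * f i j)) diagonal ⟩
  U + ∑[ i < n ] ∑[ j < n ] (lt j i * f i j) + 0
    ≡⟨ cong (λ x → U + x + 0) transposed ⟩
  U + U + 0
    ≡⟨ trans (+-identityʳ (U + U)) (cong (U +_) (sym (+-identityʳ U))) ⟩
  2 * U ∎)
  where
  open ≡-Reasoning
  U : ℕ
  U = ∑[ i < n ] ∑[ j < n ] (lt i j * f i j)
  split : ∀ i j → f i j ≡ lt i j * f i j + lt j i * f i j + δ i j * f i j
  split i j = begin
    f i j                                         ≡⟨ *-identityˡ (f i j) ⟨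
    1 * f i j                                     ≡⟨ cong (_* f i j) (lt+lt+δ i j) ⟨
    (lt i j + lt j i + δ i j) * f i j
      ≡⟨ trans (*-distribʳ-+ (f i j) (lt i j + lt j i) (δ i j))
               (cong (_+ δ i j * f i j) (*-distribʳ-+ (f i j) (lt i j) (lt j i))) ⟩
    lt i j * f i j + lt j i * f i j + δ i j * f i j ∎
  diagonal : ∑[ i < n ] ∑[ j < n ] (δ i j * f i j) ≡ 0
  diagonal = ∑-zero λ i → trans (∑-δ i (f i)) (f-diag i)
  transposed : ∑[ i < n ] ∑[ j < n ] (lt j i * f i j) ≡ U
  transposed = trans (∑-comm (λ i j → lt j i * f i j))
                     (sum-cong-≗ λ j → sum-cong-≗ λ i → cong (lt j i *_) (f-sym i j))

δ³ : ∀ {n} → Fin n → Fin n → Fin n → ℕ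
δ³ x y z = δ x y * (δ x z * δ y z)

∑∑δ³≡1 : ∀ {n} (x : Fin n) → ∑[ y < n ] ∑[ z < n ] δ³ x y z ≡ 1
∑∑δ³≡1 {n} x = begin
  ∑[ y < n ] ∑[ z < n ] δ³ x y z
    ≡⟨ sum-cong-≗ (λ y → *-distribˡ-sum (δ x y) (λ z → δ x z * δ y z)) ⟨
  ∑[ y < n ] (δ x y * ∑[ z < n ] (δ x z * δ y z))  ≡⟨ ∑-δ x (λ y → ∑[ z < n ] (δ x z * δ y z)) ⟩
  ∑[ z < n ] (δ x z * δ x z)                       ≡⟨ ∑-δ x (δ x) ⟩
  δ x x                                            ≡⟨ δ-refl x ⟩
  1                                                ∎
  where open ≡-Reasoning

length-filter-tabulate : ∀ {X : Set} {n} (P : X → Bool) (h : Fin n → X) →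
  length (filter (λ x → T? (P x)) (tabulate h)) ≡ ∑[ i < n ] 𝟙 (P (h i))
length-filter-tabulate {n = zero}  P h = refl
length-filter-tabulate {n = suc n} P h with P (h zero)
... | true  = cong suc (length-filter-tabulate P (h ∘ suc))
... | false = length-filter-tabulate P (h ∘ suc)

length-filter-concatMap : ∀ {X Y : Set} {n} (P : Y → Bool) (g : X → List Y) (h : Fin n → X) →
  length (filter (λ y → T? (P y)) (concatMap g (tabulate h)))
    ≡ ∑[ i < n ] length (filter (λ y → T? (P y)) (g (h i)))
length-filter-concatMap {n = zero}  P g h = refl
length-filter-concatMap {Y = Y} {n = suc n} P g h = begin
  length (filter P? (g (h zero) Data.List.++ concatMap g (tabulate (h ∘ suc))))
    ≡⟨ cong length (filter-++ P? (g (h zero)) _) ⟩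
  length (filter P? (g (h zero)) Data.List.++ filter P? (concatMap g (tabulate (h ∘ suc))))
    ≡⟨ length-++ (filter P? (g (h zero))) ⟩
  length (filter P? (g (h zero))) + length (filter P? (concatMap g (tabulate (h ∘ suc))))
    ≡⟨ cong (length (filter P? (g (h zero))) +_) (length-filter-concatMap P g (h ∘ suc)) ⟩
  ∑[ i < suc n ] length (filter P? (g (h i))) ∎
  where
  open ≡-Reasoning
  P? : (y : Y) → Dec (T (P y))
  P? y = T? (P y)

suc-C2 : ∀ n → suc n C 2 ≡ n + n C 2
suc-C2 n = sym (trans (cong (_+ (n C 2)) (sym (nC1≡n n))) (nCk+nC[k+1]≡[n+1]C[k+1] n 1))

2*C2+n≡n*n : ∀ n → 2 * (n C 2) + n ≡ n * n
2*C2+n≡n*n zero    = refl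
2*C2+n≡n*n (suc n) = begin
  2 * (suc n C 2) + suc n          ≡⟨ cong (λ c → 2 * c + suc n) (suc-C2 n) ⟩
  2 * (n + n C 2) + suc n          ≡⟨ regroup n (n C 2) ⟩
  (2 * (n C 2) + n) + suc (2 * n)  ≡⟨ cong (_+ suc (2 * n)) (2*C2+n≡n*n n) ⟩
  n * n + suc (2 * n)              ≡⟨ square-suc n ⟩
  suc n * suc n                    ∎
  where
  open ≡-Reasoning
  regroup : ∀ n c → 2 * (n + c) + suc n ≡ (2 * c + n) + suc (2 * n)
  regroup = solve-∀
  square-suc : ∀ n → n * n + suc (2 * n) ≡ suc n * suc n
  square-suc = solve-∀

2*C2-suc : ∀ n → 2 * (suc n C 2) ≡ suc n * n
2*C2-suc n = +-cancelʳ-≡ (suc n) _ _ (trans (2*C2+n≡n*n (suc n)) (trans (*-suc (suc n) n) (+-comm (suc n) _)))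

r≤rC2 : ∀ {r} → 3 ≤ r → r ≤ r C 2
r≤rC2 {r} 3≤r = *-cancelˡ-≤ 2 (+-cancelʳ-≤ r (2 * r) (2 * (r C 2)) (begin
  2 * r + r        ≡⟨ +-comm (2 * r) r ⟩
  3 * r            ≤⟨ *-monoˡ-≤ r 3≤r ⟩
  r * r            ≡⟨ 2*C2+n≡n*n r ⟨
  2 * (r C 2) + r  ∎))
  where open ≤-Reasoning

-- Neighbourhood counts in a graph on Fin n

A : ∀ {n} → Graph n → Fin n → Fin n → ℕ
A G x y = 𝟙 (adj G x y)

module _ {n} (G : Graph n) where

  A-sym : ∀ x y → A G x y ≡ A G y x
  A-sym x y = cong 𝟙 (adj-sym G x y)

  A-irrefl : ∀ x → A G x x ≡ 0
  A-irrefl x = cong 𝟙 (adj-irrefl G x)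

  codeg : Fin n → Fin n → ℕ
  codeg x u = ∑[ z < n ] (A G x z * A G u z)

  arcs : Fin n → ℕ
  arcs v = ∑[ u < n ] (A G v u * codeg v u)

  triangle : Fin n → Fin n → Fin n → ℕ
  triangle x y z = A G x y * (A G x z * A G y z)

  degree≡∑A : ∀ v → degree G v ≡ ∑[ u < n ] A G v u
  degree≡∑A v = length-filter-tabulate (adj G v) id

  arcs≡∑∑ : ∀ v → arcs v ≡ ∑[ a < n ] ∑[ b < n ] triangle v a b
  arcs≡∑∑ v = sum-cong-≗ λ a → *-distribˡ-sum (A G v a) (λ b → A G v b * A G a b)

  arcs≡2*eN : ∀ v → arcs v ≡ 2 * eN G v
  arcs≡2*eN v = begin
    arcs v                                                 ≡⟨ arcs≡∑∑ v ⟩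
    ∑[ a < n ] ∑[ b < n ] triangle v a b                   ≡⟨ 2*∑∑<≡∑∑ f f-sym f-diag ⟨
    2 * ∑[ a < n ] ∑[ b < n ] (lt a b * f a b)              ≡⟨ cong (2 *_) eN≡∑∑ ⟨
    2 * eN G v                                             ∎
    where
    open ≡-Reasoning
    f : Fin n → Fin n → ℕ
    f = triangle v
    f-sym : ∀ a b → f a b ≡ f b a
    f-sym a b = trans (cong (λ x → A G v a * (A G v b * x)) (A-sym a b))
                      (x∙yz≈y∙xz (A G v a) (A G v b) (A G b a))
    f-diag : ∀ a → f a a ≡ 0
    f-diag a = trans (cong (λ x → A G v a * (A G v a * x)) (A-irrefl a))
                     (trans (cong (A G v a *_) (*-zeroʳ (A G v a))) (*-zeroʳ (A G v a)))
    P : Fin n × Fin n → Bool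
    P (a , b) = (does (a <? b) ∧ adj G v a) ∧ (adj G v b ∧ adj G a b)
    𝟙P : ∀ a b → 𝟙 (P (a , b)) ≡ lt a b * f a b
    𝟙P a b rewrite 𝟙-∧ (does (a <? b) ∧ adj G v a) (adj G v b ∧ adj G a b)
                 | 𝟙-∧ (does (a <? b)) (adj G v a) | 𝟙-∧ (adj G v b) (adj G a b)
                 = *-assoc (lt a b) (A G v a) _
    eN≡∑∑ : eN G v ≡ ∑[ a < n ] ∑[ b < n ] (lt a b * f a b)
    eN≡∑∑ = trans (length-filter-concatMap P (λ a → map (a ,_) (allFin n)) id)
      (sum-cong-≗ λ a → begin
        length (filter (λ p → T? (P p)) (map (a ,_) (allFin n)))
          ≡⟨ cong (λ l → length (filter (λ p → T? (P p)) l)) (map-tabulate id (a ,_)) ⟩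
        length (filter (λ p → T? (P p)) (tabulate (a ,_)))
          ≡⟨ length-filter-tabulate P (a ,_) ⟩
        ∑[ b < n ] 𝟙 (P (a , b))
          ≡⟨ sum-cong-≗ (𝟙P a) ⟩
        ∑[ b < n ] (lt a b * f a b) ∎)

  outside : Fin n → Fin n → Bool
  outside u z = not (adj G u z ∨ does (u ≟ z))

  missing : Fin n → Fin n → ℕ
  missing x u = ∑[ z < n ] (A G x z * 𝟙 (outside u z))

  outside-sym : ∀ u z → outside u z ≡ outside z u
  outside-sym u z = cong₂ (λ a e → not (a ∨ e)) (adj-sym G u z) (does-≟-sym u z)

  codeg-sym : ∀ x u → codeg x u ≡ codeg u x
  codeg-sym x u = sum-cong-≗ λ z → *-comm (A G x z) (A G u z)

  codeg+missing+A≡degree : ∀ x u → codeg x u + missing x u + A G x u ≡ ∑[ z < n ] A G x z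
  codeg+missing+A≡degree x u = begin
    codeg x u + missing x u + A G x u
      ≡⟨ cong (codeg x u + missing x u +_) (∑-δ u (A G x)) ⟨
    codeg x u + missing x u + ∑[ z < n ] (δ u z * A G x z)
      ≡⟨ cong (_+ ∑[ z < n ] (δ u z * A G x z))
              (∑-distrib-+ (λ z → A G x z * A G u z) (λ z → A G x z * 𝟙 (outside u z))) ⟨
    ∑[ z < n ] (A G x z * A G u z + A G x z * 𝟙 (outside u z)) + ∑[ z < n ] (δ u z * A G x z)
      ≡⟨ ∑-distrib-+ (λ z → A G x z * A G u z + A G x z * 𝟙 (outside u z)) (λ z → δ u z * A G x z) ⟨
    ∑[ z < n ] (A G x z * A G u z + A G x z * 𝟙 (outside u z) + δ u z * A G x z)
      ≡⟨ sum-cong-≗ partition ⟩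
    ∑[ z < n ] A G x z ∎
    where
    open ≡-Reasoning
    partition : ∀ z → A G x z * A G u z + A G x z * 𝟙 (outside u z) + δ u z * A G x z ≡ A G x z
    partition z with u ≟ z
    ... | yes refl rewrite adj-irrefl G u | *-zeroʳ (A G x u) = +-identityʳ (A G x u)
    ... | no _ with adj G u z | A G x z
    ...   | true  | a = trans (+-identityʳ _) (trans (cong₂ _+_ (*-identityʳ a) (*-zeroʳ a)) (+-identityʳ a))
    ...   | false | a = trans (+-identityʳ _) (cong₂ _+_ (*-zeroʳ a) (*-identityʳ a))

  arcs+∑missing+d≡d² : ∀ {d} v → ∑[ u < n ] A G v u ≡ d →
    arcs v + ∑[ u < n ] (A G v u * missing v u) + d ≡ d * d
  arcs+∑missing+d≡d² {d} v deg-v = begin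
    arcs v + ∑[ u < n ] (A G v u * missing v u) + d
      ≡⟨ cong (arcs v + ∑[ u < n ] (A G v u * missing v u) +_)
              (trans (sym deg-v) (sum-cong-≗ λ u → sym (𝟙*𝟙 (adj G v u)))) ⟩
    arcs v + ∑[ u < n ] (A G v u * missing v u) + ∑[ u < n ] (A G v u * A G v u)
      ≡⟨ cong (_+ ∑[ u < n ] (A G v u * A G v u))
              (∑-distrib-+ (λ u → A G v u * codeg v u) (λ u → A G v u * missing v u)) ⟨
    ∑[ u < n ] (A G v u * codeg v u + A G v u * missing v u) + ∑[ u < n ] (A G v u * A G v u)
      ≡⟨ ∑-distrib-+ (λ u → A G v u * codeg v u + A G v u * missing v u) (λ u → A G v u * A G v u) ⟨
    ∑[ u < n ] (A G v u * codeg v u + A G v u * missing v u + A G v u * A G v u)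
      ≡⟨ sum-cong-≗ (λ u → factor (A G v u) (codeg v u) (missing v u)) ⟩
    ∑[ u < n ] (A G v u * (codeg v u + missing v u + A G v u))
      ≡⟨ sum-cong-≗ (λ u → cong (λ e → A G v u * e) (trans (codeg+missing+A≡degree v u) deg-v)) ⟩
    ∑[ u < n ] (A G v u * d)
      ≡⟨ sum-cong-≗ (λ u → *-comm (A G v u) d) ⟩
    ∑[ u < n ] (d * A G v u)
      ≡⟨ *-distribˡ-sum d (A G v) ⟨
    d * ∑[ u < n ] A G v u
      ≡⟨ cong (d *_) deg-v ⟩
    d * d ∎
    where
    open ≡-Reasoning
    factor : ∀ a c m → a * c + a * m + a * a ≡ a * (c + m + a)
    factor = solve-∀

  missing-sym : ∀ {r} → (∀ x → ∑[ z < n ] A G x z ≡ r) → ∀ x u → missing x u ≡ missing u x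
  missing-sym deg x u = +-cancelˡ-≡ (codeg x u) _ _ (+-cancelʳ-≡ (A G x u) _ _ (begin
    codeg x u + missing x u + A G x u  ≡⟨ trans (codeg+missing+A≡degree x u) (deg x) ⟩
    _                                  ≡⟨ trans (codeg+missing+A≡degree u x) (deg u) ⟨
    codeg u x + missing u x + A G u x  ≡⟨ cong₂ (λ c a → c + missing u x + a) (codeg-sym u x) (A-sym u x) ⟩
    codeg x u + missing u x + A G x u  ∎))
    where open ≡-Reasoning

  outside⇒missing>0 : ∀ {x u z} → adj G x z ≡ true → outside u z ≡ true → 0 < missing x u
  outside⇒missing>0 {x} {u} {z} xz uz =
    ≤-trans (≤-reflexive (cong₂ (λ a o → 𝟙 a * 𝟙 o) (sym xz) (sym uz)))
            (term≤∑ (λ z → A G x z * 𝟙 (outside u z)) z)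

  missing≡0⇒inside : ∀ {x u z} → missing x u ≡ 0 → adj G x z ≡ true → outside u z ≡ false
  missing≡0⇒inside {x} {u} {z} m≡0 xz with outside u z in uz
  ... | false = refl
  ... | true  = contradiction (subst (0 <_) m≡0 (outside⇒missing>0 xz uz)) (λ ())

  outside⇒¬adj : ∀ {u z} → outside u z ≡ true → adj G u z ≡ false
  outside⇒¬adj {u} {z} out with adj G u z
  ... | false = refl
  ... | true  = contradiction out λ ()

  outside⇒≢ : ∀ {u z} → outside u z ≡ true → u ≢ z
  outside⇒≢ {u} out refl rewrite adj-irrefl G u | dec-true (u ≟ u) refl = contradiction out λ ()

  ¬adj∧≢⇒outside : ∀ {u z} → adj G u z ≡ false → u ≢ z → outside u z ≡ true
  ¬adj∧≢⇒outside {u} {z} ¬uz u≢z rewrite ¬uz | dec-false (u ≟ z) u≢z = refl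

  inside∧≢⇒adj : ∀ {u z} → outside u z ≡ false → u ≢ z → adj G u z ≡ true
  inside∧≢⇒adj {u} {z} inside u≢z with adj G u z | u ≟ z
  ... | true  | _        = refl
  ... | false | yes u≡z  = contradiction u≡z u≢z
  ... | false | no _     = contradiction inside λ ()

IsConstant₂ : ∀ {n} → Graph n → ℕ → ℕ → Set
IsConstant₂ {n} G r t = (∀ v → ∑[ u < n ] A G v u ≡ r) × (∀ v → arcs G v ≡ t)

InSpec₂ : ℕ → ℕ → Set
InSpec₂ r t = Σ ℕ λ n → Σ (Graph (suc n)) λ G → IsConstant₂ G r t

isConstant⇒isConstant₂ : ∀ {n r c} {G : Graph n} → IsConstant G r c → IsConstant₂ G r (2 * c)
isConstant⇒isConstant₂ {G = G} (reg , e≡c) =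
  (λ v → trans (sym (degree≡∑A G v)) (reg v)) , (λ v → trans (arcs≡2*eN G v) (cong (2 *_) (e≡c v)))

inSpec₂⇒inSpec : ∀ {r c} → InSpec₂ r (2 * c) → InSpec r c
inSpec₂⇒inSpec {c = c} (n , G , deg , arcs≡) =
  n , G , (λ v → trans (degree≡∑A G v) (deg v))
        , (λ v → *-cancelˡ-≡ (eN G v) c 2 (trans (sym (arcs≡2*eN G v)) (arcs≡ v)))

-- Complete graphs and Cartesian products

K : ∀ m → Graph (suc m)
K m = record
  { adj    = λ i j → not (does (i ≟ j))
  ; sym    = λ i j → cong not (does-≟-sym i j)
  ; irrefl = λ i → cong not (dec-true (i ≟ i) refl)
  }

K-outside : ∀ {m} (u z : Fin (suc m)) → outside (K m) u z ≡ false
K-outside u z with does (u ≟ z)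
... | true  = refl
... | false = refl

K-degree : ∀ m v → ∑[ u < suc m ] A (K m) v u ≡ m
K-degree m v = +-cancelʳ-≡ 1 _ _ (begin
  ∑[ u < suc m ] A (K m) v u + 1                     ≡⟨ cong (∑[ u < suc m ] A (K m) v u +_) (∑-δ-count v) ⟨
  ∑[ u < suc m ] A (K m) v u + ∑[ u < suc m ] δ v u  ≡⟨ ∑-distrib-+ (A (K m) v) (δ v) ⟨
  ∑[ u < suc m ] (A (K m) v u + δ v u)               ≡⟨ sum-cong-≗ (λ u → 𝟙-not+𝟙 (does (v ≟ u))) ⟩
  ∑[ u < suc m ] 1                                   ≡⟨ ∑-const (suc m) 1 ⟩
  suc m * 1                                          ≡⟨ trans (*-identityʳ (suc m)) (+-comm 1 m) ⟩
  m + 1                                              ∎)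
  where
  open ≡-Reasoning
  𝟙-not+𝟙 : ∀ b → 𝟙 (not b) + 𝟙 b ≡ 1
  𝟙-not+𝟙 true  = refl
  𝟙-not+𝟙 false = refl

K-arcs : ∀ m v → arcs (K m) v ≡ 2 * (m C 2)
K-arcs m v = +-cancelʳ-≡ m _ _ (begin
  arcs (K m) v + m
    ≡⟨ cong (_+ m) (+-identityʳ (arcs (K m) v)) ⟨
  arcs (K m) v + 0 + m
    ≡⟨ cong (λ s → arcs (K m) v + s + m) no-missing ⟨
  arcs (K m) v + ∑[ u < suc m ] (A (K m) v u * missing (K m) v u) + m
    ≡⟨ arcs+∑missing+d≡d² (K m) v (K-degree m v) ⟩
  m * m
    ≡⟨ 2*C2+n≡n*n m ⟨
  2 * (m C 2) + m ∎)
  where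
  open ≡-Reasoning
  missing≡0 : ∀ u → missing (K m) v u ≡ 0
  missing≡0 u = ∑-zero λ z → trans (cong (λ b → A (K m) v z * 𝟙 b) (K-outside u z)) (*-zeroʳ (A (K m) v z))
  no-missing : ∑[ u < suc m ] (A (K m) v u * missing (K m) v u) ≡ 0
  no-missing = ∑-zero λ u → trans (cong (A (K m) v u *_) (missing≡0 u)) (*-zeroʳ (A (K m) v u))

δxy*δxz*Ayz≡0 : ∀ {n} (G : Graph n) x y z → δ x y * (δ x z * A G y z) ≡ 0
δxy*δxz*Ayz≡0 G x y z with x ≟ y | x ≟ z
... | no x≢y   | _        = refl
... | yes refl | no x≢z   = refl
... | yes refl | yes refl = trans (+-identityʳ _) (trans (+-identityʳ _) (A-irrefl G x))

δxy*δyz*Axz≡0 : ∀ {n} (G : Graph n) x y z → δ x y * (δ y z * A G x z) ≡ 0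
δxy*δyz*Axz≡0 G x y z = trans (cong (λ d → d * (δ y z * A G x z)) (δ-sym x y)) (δxy*δxz*Ayz≡0 G y x z)

δxz*δyz*Axy≡0 : ∀ {n} (G : Graph n) x y z → δ x z * (δ y z * A G x y) ≡ 0
δxz*δyz*Axy≡0 G x y z =
  trans (cong₂ (λ d e → d * (e * A G x y)) (δ-sym x z) (δ-sym y z)) (δxy*δxz*Ayz≡0 G z x y)

cube-expansion : ∀ a₁ b₁ c₁ d₁ a₂ b₂ c₂ d₂ a₃ b₃ c₃ d₃ →
  b₁ * (b₂ * d₃) ≡ 0 → b₁ * (b₃ * d₂) ≡ 0 → b₂ * (b₃ * d₁) ≡ 0 →
  c₁ * (c₂ * a₃) ≡ 0 → c₁ * (c₃ * a₂) ≡ 0 → c₂ * (c₃ * a₁) ≡ 0 →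
  (a₁ * b₁ + c₁ * d₁) * ((a₂ * b₂ + c₂ * d₂) * (a₃ * b₃ + c₃ * d₃))
    ≡ a₁ * (a₂ * a₃) * (b₁ * (b₂ * b₃)) + c₁ * (c₂ * c₃) * (d₁ * (d₂ * d₃))
cube-expansion a₁ b₁ c₁ d₁ a₂ b₂ c₂ d₂ a₃ b₃ c₃ d₃ e₁ e₂ e₃ e₄ e₅ e₆ =
  trans (expand a₁ b₁ c₁ d₁ a₂ b₂ c₂ d₂ a₃ b₃ c₃ d₃) (trans (cong (pure +_) mixed≡0) (+-identityʳ pure))
  where
  pure : ℕ
  pure = a₁ * (a₂ * a₃) * (b₁ * (b₂ * b₃)) + c₁ * (c₂ * c₃) * (d₁ * (d₂ * d₃))
  mixed≡0 : b₁ * (b₂ * d₃) * (a₁ * a₂ * c₃) + b₁ * (b₃ * d₂) * (a₁ * c₂ * a₃)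
            + b₂ * (b₃ * d₁) * (c₁ * a₂ * a₃) + c₁ * (c₂ * a₃) * (d₁ * d₂ * b₃)
            + c₁ * (c₃ * a₂) * (d₁ * b₂ * d₃) + c₂ * (c₃ * a₁) * (b₁ * d₂ * d₃) ≡ 0
  mixed≡0 rewrite e₁ | e₂ | e₃ | e₄ | e₅ | e₆ = refl
  expand : ∀ a₁ b₁ c₁ d₁ a₂ b₂ c₂ d₂ a₃ b₃ c₃ d₃ →
    (a₁ * b₁ + c₁ * d₁) * ((a₂ * b₂ + c₂ * d₂) * (a₃ * b₃ + c₃ * d₃))
      ≡ a₁ * (a₂ * a₃) * (b₁ * (b₂ * b₃)) + c₁ * (c₂ * c₃) * (d₁ * (d₂ * d₃))
        + (b₁ * (b₂ * d₃) * (a₁ * a₂ * c₃) + b₁ * (b₃ * d₂) * (a₁ * c₂ * a₃)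
           + b₂ * (b₃ * d₁) * (c₁ * a₂ * a₃) + c₁ * (c₂ * a₃) * (d₁ * d₂ * b₃)
           + c₁ * (c₃ * a₂) * (d₁ * b₂ * d₃) + c₂ * (c₃ * a₁) * (b₁ * d₂ * d₃))
  expand = solve-∀

module _ {p q} (G : Graph p) (H : Graph q) where

  adj□ : Fin p × Fin q → Fin p × Fin q → Bool
  adj□ (x₁ , x₂) (y₁ , y₂) = (adj G x₁ y₁ ∧ does (x₂ ≟ y₂)) ∨ (does (x₁ ≟ y₁) ∧ adj H x₂ y₂)

  adj□-sym : ∀ X Y → adj□ X Y ≡ adj□ Y X
  adj□-sym (x₁ , x₂) (y₁ , y₂)
    rewrite adj-sym G x₁ y₁ | adj-sym H x₂ y₂ | does-≟-sym x₁ y₁ | does-≟-sym x₂ y₂ = refl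

  adj□-irrefl : ∀ X → adj□ X X ≡ false
  adj□-irrefl (x₁ , x₂) rewrite adj-irrefl G x₁ | adj-irrefl H x₂ | dec-true (x₁ ≟ x₁) refl = refl

  coords : Fin (p * q) → Fin p × Fin q
  coords = remQuot q

  _□_ : Graph (p * q)
  _□_ = record
    { adj    = λ x y → adj□ (coords x) (coords y)
    ; sym    = λ x y → adj□-sym (coords x) (coords y)
    ; irrefl = λ x → adj□-irrefl (coords x)
    }

  A□ : Fin p × Fin q → Fin p × Fin q → ℕ
  A□ (x₁ , x₂) (y₁ , y₂) = A G x₁ y₁ * δ x₂ y₂ + δ x₁ y₁ * A H x₂ y₂

  triangle□ : Fin p × Fin q → Fin p × Fin q → Fin p × Fin q → ℕ
  triangle□ X Y Z = 𝟙 (adj□ X Y) * (𝟙 (adj□ X Z) * 𝟙 (adj□ Y Z))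

  𝟙-adj□ : ∀ X Y → 𝟙 (adj□ X Y) ≡ A□ X Y
  𝟙-adj□ (x₁ , x₂) (y₁ , y₂) with x₁ ≟ y₁
  ... | yes refl rewrite adj-irrefl G x₁ = sym (+-identityʳ (A H x₂ y₂))
  ... | no _ with adj G x₁ y₁ | does (x₂ ≟ y₂)
  ...   | true  | true  = refl
  ...   | true  | false = refl
  ...   | false | _     = refl

  degree□ : ∀ x → ∑[ y < p * q ] A _□_ x y
                ≡ ∑[ y < p ] A G (proj₁ (coords x)) y + ∑[ y < q ] A H (proj₂ (coords x)) y
  degree□ x = go (coords x)
    where
    go : ∀ X → ∑[ y < p * q ] 𝟙 (adj□ X (coords y))
             ≡ ∑[ y < p ] A G (proj₁ X) y + ∑[ y < q ] A H (proj₂ X) y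
    go X@(x₁ , x₂) = begin
      ∑[ y < p * q ] 𝟙 (adj□ X (coords y))
        ≡⟨ ∑-remQuot p q (λ Y → 𝟙 (adj□ X Y)) ⟩
      ∑[ y₁ < p ] ∑[ y₂ < q ] 𝟙 (adj□ X (y₁ , y₂))
        ≡⟨ sum-cong-≗ (λ y₁ → sum-cong-≗ λ y₂ → 𝟙-adj□ X (y₁ , y₂)) ⟩
      ∑[ y₁ < p ] ∑[ y₂ < q ] (A G x₁ y₁ * δ x₂ y₂ + δ x₁ y₁ * A H x₂ y₂)
        ≡⟨ ∑∑-distrib-+ (λ y₁ y₂ → A G x₁ y₁ * δ x₂ y₂) (λ y₁ y₂ → δ x₁ y₁ * A H x₂ y₂) ⟩
      ∑[ y₁ < p ] ∑[ y₂ < q ] (A G x₁ y₁ * δ x₂ y₂) + ∑[ y₁ < p ] ∑[ y₂ < q ] (δ x₁ y₁ * A H x₂ y₂)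
        ≡⟨ cong₂ _+_ (sum-cong-≗ λ y₁ → sym (*-distribˡ-sum (A G x₁ y₁) (δ x₂)))
                     (sum-cong-≗ λ y₁ → sym (*-distribˡ-sum (δ x₁ y₁) (A H x₂))) ⟩
      ∑[ y₁ < p ] (A G x₁ y₁ * ∑[ y₂ < q ] δ x₂ y₂) + ∑[ y₁ < p ] (δ x₁ y₁ * ∑[ y₂ < q ] A H x₂ y₂)
        ≡⟨ cong₂ _+_ (sum-cong-≗ λ y₁ → trans (cong (A G x₁ y₁ *_) (∑-δ-count x₂)) (*-identityʳ (A G x₁ y₁)))
                     (∑-δ x₁ (λ _ → ∑[ y₂ < q ] A H x₂ y₂)) ⟩
      ∑[ y₁ < p ] A G x₁ y₁ + ∑[ y₂ < q ] A H x₂ y₂ ∎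
      where open ≡-Reasoning

  -- Each of the six mixed terms pairs two δ's with an adjacency on the three sides of a triangle.
  triangle□-split : ∀ x₁ x₂ y₁ y₂ z₁ z₂ → triangle□ (x₁ , x₂) (y₁ , y₂) (z₁ , z₂)
    ≡ triangle G x₁ y₁ z₁ * δ³ x₂ y₂ z₂ + δ³ x₁ y₁ z₁ * triangle H x₂ y₂ z₂
  triangle□-split x₁ x₂ y₁ y₂ z₁ z₂ = begin
    triangle□ X Y Z
      ≡⟨ cong₂ _*_ (𝟙-adj□ X Y) (cong₂ _*_ (𝟙-adj□ X Z) (𝟙-adj□ Y Z)) ⟩
    A□ X Y * (A□ X Z * A□ Y Z)
      ≡⟨ cube-expansion (A G x₁ y₁) (δ x₂ y₂) (δ x₁ y₁) (A H x₂ y₂)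
                        (A G x₁ z₁) (δ x₂ z₂) (δ x₁ z₁) (A H x₂ z₂)
                        (A G y₁ z₁) (δ y₂ z₂) (δ y₁ z₁) (A H y₂ z₂)
                        (δxy*δxz*Ayz≡0 H x₂ y₂ z₂) (δxy*δyz*Axz≡0 H x₂ y₂ z₂) (δxz*δyz*Axy≡0 H x₂ y₂ z₂)
                        (δxy*δxz*Ayz≡0 G x₁ y₁ z₁) (δxy*δyz*Axz≡0 G x₁ y₁ z₁) (δxz*δyz*Axy≡0 G x₁ y₁ z₁) ⟩
    triangle G x₁ y₁ z₁ * δ³ x₂ y₂ z₂ + δ³ x₁ y₁ z₁ * triangle H x₂ y₂ z₂ ∎
    where
    open ≡-Reasoning
    X Y Z : Fin p × Fin q
    X = (x₁ , x₂)
    Y = (y₁ , y₂)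
    Z = (z₁ , z₂)

  arcs□ : ∀ x → arcs _□_ x ≡ arcs G (proj₁ (coords x)) + arcs H (proj₂ (coords x))
  arcs□ x = trans (arcs≡∑∑ _□_ x) (go (coords x))
    where
    go : ∀ X → ∑[ y < p * q ] ∑[ z < p * q ] triangle□ X (coords y) (coords z)
             ≡ arcs G (proj₁ X) + arcs H (proj₂ X)
    go X@(x₁ , x₂) = begin
      ∑[ y < p * q ] ∑[ z < p * q ] triangle□ X (coords y) (coords z)
        ≡⟨ ∑-remQuot p q (λ Y → ∑[ z < p * q ] triangle□ X Y (coords z)) ⟩
      ∑[ y₁ < p ] ∑[ y₂ < q ] ∑[ z < p * q ] triangle□ X (y₁ , y₂) (coords z)
        ≡⟨ sum-cong-≗ (λ y₁ → sum-cong-≗ λ y₂ → ∑-remQuot p q (triangle□ X (y₁ , y₂))) ⟩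
      ∑[ y₁ < p ] ∑[ y₂ < q ] ∑[ z₁ < p ] ∑[ z₂ < q ] triangle□ X (y₁ , y₂) (z₁ , z₂)
        ≡⟨ sum-cong-≗ (λ y₁ → ∑-comm (λ y₂ z₁ → ∑[ z₂ < q ] triangle□ X (y₁ , y₂) (z₁ , z₂))) ⟩
      ∑[ y₁ < p ] ∑[ z₁ < p ] ∑[ y₂ < q ] ∑[ z₂ < q ] triangle□ X (y₁ , y₂) (z₁ , z₂)
        ≡⟨ (sum-cong-≗ λ y₁ → sum-cong-≗ λ z₁ → sum-cong-≗ λ y₂ → sum-cong-≗ λ z₂ →
              triangle□-split x₁ x₂ y₁ y₂ z₁ z₂) ⟩
      ∑[ y₁ < p ] ∑[ z₁ < p ] ∑[ y₂ < q ] ∑[ z₂ < q ]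
        (triangle G x₁ y₁ z₁ * δ³ x₂ y₂ z₂ + δ³ x₁ y₁ z₁ * triangle H x₂ y₂ z₂)
        ≡⟨ ∑∑∑∑-distrib-+ (λ y₁ z₁ y₂ z₂ → triangle G x₁ y₁ z₁ * δ³ x₂ y₂ z₂)
                          (λ y₁ z₁ y₂ z₂ → δ³ x₁ y₁ z₁ * triangle H x₂ y₂ z₂) ⟩
      _
        ≡⟨ cong₂ _+_ (∑∑-*-∑∑ (triangle G x₁) (δ³ x₂)) (∑∑-*-∑∑ (δ³ x₁) (triangle H x₂)) ⟩
      ∑[ y₁ < p ] ∑[ z₁ < p ] triangle G x₁ y₁ z₁ * ∑[ y₂ < q ] ∑[ z₂ < q ] δ³ x₂ y₂ z₂
        + ∑[ y₁ < p ] ∑[ z₁ < p ] δ³ x₁ y₁ z₁ * ∑[ y₂ < q ] ∑[ z₂ < q ] triangle H x₂ y₂ z₂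
        ≡⟨ cong₂ _+_ (cong₂ _*_ (arcs≡∑∑ G x₁) (sym (∑∑δ³≡1 x₂)))
                     (cong₂ _*_ (sym (∑∑δ³≡1 x₁)) (arcs≡∑∑ H x₂)) ⟨
      arcs G x₁ * 1 + 1 * arcs H x₂
        ≡⟨ cong₂ _+_ (*-identityʳ (arcs G x₁)) (*-identityˡ (arcs H x₂)) ⟩
      arcs G x₁ + arcs H x₂ ∎
      where open ≡-Reasoning

inSpec₂-K : ∀ m → InSpec₂ m (2 * (m C 2))
inSpec₂-K m = m , K m , K-degree m , K-arcs m

inSpec₂-□ : ∀ {r₁ t₁ r₂ t₂} → InSpec₂ r₁ t₁ → InSpec₂ r₂ t₂ → InSpec₂ (r₁ + r₂) (t₁ + t₂)
inSpec₂-□ (n₁ , G , deg₁ , arcs₁) (n₂ , H , deg₂ , arcs₂) =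
  n₂ + n₁ * suc n₂ , G □ H ,
  (λ v → trans (degree□ G H v) (cong₂ _+_ (deg₁ _) (deg₂ _))) ,
  (λ v → trans (arcs□ G H v) (cong₂ _+_ (arcs₁ _) (arcs₂ _)))

inSpec₂-power : ∀ {r t} → InSpec₂ r t → ∀ k → InSpec₂ (k * r) (k * t)
inSpec₂-power _ zero    = inSpec₂-K 0
inSpec₂-power s (suc k) = inSpec₂-□ s (inSpec₂-power s k)

inSpec₂-sum : ∀ m a b p → InSpec₂ (m + a + 2 * b + p) (2 * (m C 2 + a C 2 + b))
inSpec₂-sum m a b p =
  subst₂ InSpec₂ (regroup m a b p) (distribute (m C 2) (a C 2) b p)
    (inSpec₂-□ (inSpec₂-□ (inSpec₂-□ (inSpec₂-K m) (inSpec₂-K a)) (inSpec₂-power (inSpec₂-K 2) b))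
               (inSpec₂-power (inSpec₂-K 1) p))
  where
  regroup : ∀ m a b p → m + a + b * 2 + p * 1 ≡ m + a + 2 * b + p
  regroup = solve-∀
  distribute : ∀ x y b p → 2 * x + 2 * y + b * 2 + p * 0 ≡ 2 * (x + y + b)
  distribute = solve-∀

-- Part (i): the greedy decomposition of c

C2-floor : ∀ c → ∃[ m ] ∃[ d ] m C 2 + d ≡ c × d < m
C2-floor zero = 1 , 0 , refl , s≤s z≤n
C2-floor (suc c) with C2-floor c
... | m , d , eq , d<m with suc d <ℕ? m
...   | yes d+1<m = m , suc d , trans (+-suc (m C 2) d) (cong suc eq) , d+1<m
...   | no  d+1≮m = suc m , 0 , (begin
  suc m C 2 + 0    ≡⟨ +-identityʳ (suc m C 2) ⟩
  suc m C 2        ≡⟨ suc-C2 m ⟩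
  m + m C 2        ≡⟨ cong (_+ m C 2) (≤-antisym (≮⇒≥ d+1≮m) d<m) ⟩
  suc d + m C 2    ≡⟨ cong suc (trans (+-comm d (m C 2)) eq) ⟩
  suc c            ∎) , s≤s z≤n
  where open ≡-Reasoning

suc-m*m≤r*r⇒m<r : ∀ {m r} → 1 ≤ r → suc m * m ≤ r * r → m < r
suc-m*m≤r*r⇒m<r {m} {r} r≥1 sm*m≤r*r with m <ℕ? r
... | yes m<r = m<r
... | no  m≮r = contradiction (begin-strict
  r * r       <⟨ m<n+m (r * r) r≥1 ⟩
  suc r * r   ≤⟨ *-mono-≤ (s≤s r≤m) r≤m ⟩
  suc m * m   ≤⟨ sm*m≤r*r ⟩
  r * r       ∎) (<-irrefl refl)
  where
  open ≤-Reasoning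
  r≤m = ≮⇒≥ m≮r

excess-bound : ∀ {r m t c} → m + t ≡ r → 1 ≤ r → 2 * (m C 2) ≤ 2 * c →
  100 * r ^ 3 ≤ (r ^ 2 ∸ 2 * c) ^ 2 → 100 * r ≤ (2 * t + 1) ^ 2
excess-bound {r} {m} {t} {c} refl r≥1 C2≤c hyp =
  *-cancelˡ-≤ (r * r) {{m*n≢0 r r {{>-nonZero r≥1}} {{>-nonZero r≥1}}}} (begin
    r * r * (100 * r)          ≡⟨ cube r ⟩
    100 * r ^ 3                ≤⟨ hyp ⟩
    (r ^ 2 ∸ 2 * c) ^ 2        ≤⟨ ^-monoˡ-≤ 2 deficit≤ ⟩
    (r * (2 * t + 1)) ^ 2      ≡⟨ square-product r (2 * t + 1) ⟩
    r * r * (2 * t + 1) ^ 2    ∎)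
  where
  open ≤-Reasoning
  cube : ∀ r → r * r * (100 * r) ≡ 100 * (r * (r * (r * 1)))
  cube = solve-∀
  square-product : ∀ r s → r * s * (r * s * 1) ≡ r * r * (s * (s * 1))
  square-product = solve-∀
  expand : ∀ m t → (m + t) * ((m + t) * 1) + m + (t * t + t) ≡ m * m + (m + t) * (2 * t + 1)
  expand = solve-∀
  r²≤ : r ^ 2 ≤ 2 * c + r * (2 * t + 1)
  r²≤ = +-cancelʳ-≤ m _ _ (begin
    r ^ 2 + m                          ≤⟨ m≤m+n (r ^ 2 + m) (t * t + t) ⟩
    r ^ 2 + m + (t * t + t)            ≡⟨ expand m t ⟩
    m * m + r * (2 * t + 1)            ≡⟨ cong (_+ r * (2 * t + 1)) (2*C2+n≡n*n m) ⟨
    2 * (m C 2) + m + r * (2 * t + 1)  ≤⟨ +-monoˡ-≤ (r * (2 * t + 1)) (+-monoˡ-≤ m C2≤c) ⟩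
    2 * c + m + r * (2 * t + 1)        ≡⟨ swap (2 * c) m (r * (2 * t + 1)) ⟩
    2 * c + r * (2 * t + 1) + m        ∎)
    where
    swap : ∀ a b x → a + b + x ≡ a + x + b
    swap = solve-∀
  deficit≤ : r ^ 2 ∸ 2 * c ≤ r * (2 * t + 1)
  deficit≤ = m≤n+o⇒m∸n≤o (r ^ 2) (2 * c) r²≤

overshoot-bound : ∀ {t a r} → t ≤ 3 * a → suc a C 2 ≤ r → (t + 3) * t ≤ 18 * r
overshoot-bound {t} {a} {r} t≤3a C≤r = begin
  (t + 3) * t              ≤⟨ *-mono-≤ (+-monoˡ-≤ 3 t≤3a) t≤3a ⟩
  (3 * a + 3) * (3 * a)    ≡⟨ nine a ⟩
  9 * (suc a * a)          ≡⟨ cong (9 *_) (2*C2-suc a) ⟨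
  9 * (2 * (suc a C 2))    ≤⟨ *-monoʳ-≤ 9 (*-monoʳ-≤ 2 C≤r) ⟩
  9 * (2 * r)              ≡⟨ *-assoc 9 2 r ⟨
  18 * r                   ∎
  where
  open ≤-Reasoning
  nine : ∀ a → (3 * a + 3) * (3 * a) ≡ 9 * (suc a * a)
  nine = solve-∀

no-small-gap : ∀ t {r} → 1 ≤ r → (t + 3) * t ≤ 18 * r → 100 * r ≤ (2 * t + 1) ^ 2 → ⊥
no-small-gap zero    r≥1 _ 100r≤1 = contradiction 100≤1 λ { (s≤s ()) }
  where
  100≤1 : 100 ≤ 1
  100≤1 = ≤-trans (*-monoʳ-≤ 100 r≥1) 100r≤1
no-small-gap (suc t) {r} _ quadratic≤ 100r≤ = <-irrefl refl (begin-strict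
  18 * (2 * suc t + 1) ^ 2                           <⟨ m<m+n _ (s≤s z≤n) ⟩
  18 * (2 * suc t + 1) ^ 2 + suc (28 * (t * t) + 284 * t + 237)
                                                     ≡⟨ gap t ⟩
  100 * ((suc t + 3) * suc t)                        ≤⟨ *-monoʳ-≤ 100 quadratic≤ ⟩
  100 * (18 * r)                                     ≡⟨ *-comm 100 (18 * r) ⟩
  18 * r * 100                                       ≡⟨ *-assoc 18 r 100 ⟩
  18 * (r * 100)                                     ≡⟨ cong (18 *_) (*-comm r 100) ⟩
  18 * (100 * r)                                     ≤⟨ *-monoʳ-≤ 18 100r≤ ⟩
  18 * (2 * suc t + 1) ^ 2                           ∎)
  where
  open ≤-Reasoning
  gap : ∀ t → 18 * ((2 * suc t + 1) * ((2 * suc t + 1) * 1)) + suc (28 * (t * t) + 284 * t + 237)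
            ≡ 100 * ((suc t + 3) * suc t)
  gap = solve-∀

greedy-decomposition : ∀ {r c} → 1 ≤ r → 2 * c ≤ r ^ 2 → 100 * r ^ 3 ≤ (r ^ 2 ∸ 2 * c) ^ 2 →
  ∃[ m ] ∃[ a ] ∃[ b ] m C 2 + a C 2 + b ≡ c × m + a + 2 * b ≤ r
greedy-decomposition {r} {c} r≥1 2c≤r² hyp with C2-floor c
... | zero , d , _ , ()
... | suc m′ , d , m+d≡c , d<m with C2-floor d
...   | zero , b , _ , ()
...   | suc a′ , b , a+b≡d , s≤s b≤a′ = m , a , b , decomposition , fits
  where
  m a : ℕ
  m = suc m′
  a = suc a′
  decomposition : m C 2 + a C 2 + b ≡ c
  decomposition = trans (+-assoc (m C 2) (a C 2) b) (trans (cong (m C 2 +_) a+b≡d) m+d≡c)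
  2C2≤2c : 2 * (m C 2) ≤ 2 * c
  2C2≤2c = *-monoʳ-≤ 2 (≤-trans (m≤m+n (m C 2) d) (≤-reflexive m+d≡c))
  m≤r : m ≤ r
  m≤r = suc-m*m≤r*r⇒m<r r≥1 (begin
    suc m′ * m′    ≡⟨ 2*C2-suc m′ ⟨
    2 * (m C 2)    ≤⟨ 2C2≤2c ⟩
    2 * c          ≤⟨ 2c≤r² ⟩
    r * (r * 1)    ≡⟨ cong (r *_) (*-identityʳ r) ⟩
    r * r          ∎)
    where open ≤-Reasoning
  t : ℕ
  t = r ∸ m
  m+t≡r : m + t ≡ r
  m+t≡r = m+[n∸m]≡n m≤r
  aC2≤r : a C 2 ≤ r
  aC2≤r = ≤-trans (m≤m+n (a C 2) b) (≤-trans (≤-reflexive a+b≡d) (<⇒≤ (<-≤-trans d<m m≤r)))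
  t≤3a′ : m + a + 2 * b ≰ r → t ≤ 3 * a′
  t≤3a′ overshoot = s≤s⁻¹ (+-cancelˡ-≤ m (suc t) (suc (3 * a′)) (begin
    m + suc t          ≡⟨ trans (+-suc m t) (cong suc m+t≡r) ⟩
    suc r              ≤⟨ ≰⇒> overshoot ⟩
    m + a + 2 * b      ≤⟨ +-monoʳ-≤ (m + a) (*-monoʳ-≤ 2 b≤a′) ⟩
    m + a + 2 * a′     ≡⟨ regroup m a′ ⟩
    m + suc (3 * a′)   ∎))
    where
    open ≤-Reasoning
    regroup : ∀ m a → m + suc a + 2 * a ≡ m + suc (3 * a)
    regroup = solve-∀
  fits : m + a + 2 * b ≤ r
  fits with m + a + 2 * b ≤ℕ? r
  ... | yes fits = fits
  ... | no overshoot = ⊥-elim (no-small-gap t r≥1 (overshoot-bound {a = a′} (t≤3a′ overshoot) aC2≤r)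
                                              (excess-bound {m = m} {c = c} m+t≡r r≥1 2C2≤2c hyp))

-- Part (ii): nearly complete neighbourhoods

missing-sum-of-deficit : ∀ {n r k} (G : Graph n) → k ≤ r C 2 → IsConstant₂ G r (2 * (r C 2 ∸ k)) →
  ∀ v → ∑[ u < n ] (A G v u * missing G v u) ≡ 2 * k
missing-sum-of-deficit {n} {r} {k} G k≤rC2 (regular , arcs≡) v =
  +-cancelˡ-≡ (arcs G v) _ _ (+-cancelʳ-≡ r _ _ (begin
    arcs G v + ∑[ u < n ] (A G v u * missing G v u) + r  ≡⟨ arcs+∑missing+d≡d² G v (regular v) ⟩
    r * r                                                ≡⟨ 2*C2+n≡n*n r ⟨
    2 * (r C 2) + r                                      ≡⟨ cong (λ x → 2 * x + r) (m∸n+n≡m k≤rC2) ⟨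
    2 * (r C 2 ∸ k + k) + r                              ≡⟨ cong (_+ r) (*-distribˡ-+ 2 (r C 2 ∸ k) k) ⟩
    2 * (r C 2 ∸ k) + 2 * k + r                          ≡⟨ cong (λ a → a + 2 * k + r) (arcs≡ v) ⟨
    arcs G v + 2 * k + r                                 ∎))
  where open ≡-Reasoning

module NearlyComplete {n r k} (G : Graph n) (regular : ∀ v → ∑[ u < n ] A G v u ≡ r)
  (∑missing≡2k : ∀ v → ∑[ u < n ] (A G v u * missing G v u) ≡ 2 * k) (k≥1 : 1 ≤ k) (v : Fin n) where

  -- u ∈ N(v) with N(v) ⊆ N[u]
  full : Fin n → Bool
  full u = adj G v u ∧ (missing G v u ≡ᵇ 0)

  #full : ℕ
  #full = ∑[ u < n ] 𝟙 (full u)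

  full⇒adj×missing≡0 : ∀ {u} → full u ≡ true → adj G v u ≡ true × missing G v u ≡ 0
  full⇒adj×missing≡0 {u} fu with adj G v u | missing G v u
  ... | true  | zero  = refl , refl
  ... | true  | suc _ = contradiction fu λ ()
  ... | false | _     = contradiction fu λ ()

  r≤#full+2k : r ≤ #full + 2 * k
  r≤#full+2k = begin
    r                                                              ≡⟨ regular v ⟨
    ∑[ u < n ] A G v u                                             ≤⟨ ∑-mono-≤ pointwise ⟩
    ∑[ u < n ] (𝟙 (full u) + A G v u * missing G v u)              ≡⟨ ∑-distrib-+ (𝟙 ∘ full) _ ⟩
    #full + ∑[ u < n ] (A G v u * missing G v u)                   ≡⟨ cong (#full +_) (∑missing≡2k v) ⟩
    #full + 2 * k                                                  ∎
    where
    open ≤-Reasoning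
    pointwise : ∀ u → A G v u ≤ 𝟙 (full u) + A G v u * missing G v u
    pointwise u with adj G v u | missing G v u
    ... | false | _     = z≤n
    ... | true  | zero  = ≤-refl
    ... | true  | suc _ = s≤s z≤n

  ∃-unfull : ∃[ w ] 0 < A G v w * missing G v w
  ∃-unfull = ∑>0⇒∃>0 (λ w → A G v w * missing G v w)
    (subst (0 <_) (sym (∑missing≡2k v)) (≤-trans (s≤s z≤n) (*-monoʳ-≤ 2 k≥1)))

  module Unfull {w} (vw : adj G v w ≡ true) (missing-vw>0 : 0 < missing G v w) where

    ∃-outside : ∃[ t ] 0 < A G w t * 𝟙 (outside G v t)
    ∃-outside = ∑>0⇒∃>0 (λ t → A G w t * 𝟙 (outside G v t))
      (subst (0 <_) (missing-sym G regular v w) missing-vw>0)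

    module Outside {t} (wt : adj G w t ≡ true) (vt : outside G v t ≡ true) where

      full⇒adj-w : ∀ {f} → full f ≡ true → adj G f w ≡ true
      full⇒adj-w {f} ff = inside∧≢⇒adj G (missing≡0⇒inside G missing-vf≡0 vw) f≢w
        where
        missing-vf≡0 : missing G v f ≡ 0
        missing-vf≡0 = proj₂ (full⇒adj×missing≡0 ff)
        f≢w : f ≢ w
        f≢w refl = contradiction (subst (0 <_) missing-vf≡0 missing-vw>0) λ ()

      full⇒outside-t : ∀ {f} → full f ≡ true → outside G f t ≡ true
      full⇒outside-t {f} ff = ¬adj∧≢⇒outside G ¬ft f≢t
        where
        vf : adj G v f ≡ true
        vf = proj₁ (full⇒adj×missing≡0 ff)
        missing-fv≡0 : missing G f v ≡ 0
        missing-fv≡0 = trans (missing-sym G regular f v) (proj₂ (full⇒adj×missing≡0 ff))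
        ¬ft : adj G f t ≡ false
        ¬ft with adj G f t in ft
        ... | false = refl
        ... | true  = contradiction (trans (sym vt) (missing≡0⇒inside G missing-fv≡0 ft)) λ ()
        f≢t : f ≢ t
        f≢t refl = contradiction (trans (sym vf) (outside⇒¬adj G vt)) λ ()

      full-v≡false : full v ≡ false
      full-v≡false rewrite adj-irrefl G v = refl

      full-t≡false : full t ≡ false
      full-t≡false rewrite outside⇒¬adj G vt = refl

      #full+1≤missing-wt : #full + 1 ≤ missing G w t
      #full+1≤missing-wt = begin
        #full + 1                                        ≡⟨ cong (#full +_) (∑-δ-count v) ⟨
        #full + ∑[ z < n ] δ v z                         ≡⟨ ∑-distrib-+ (𝟙 ∘ full) (δ v) ⟨
        ∑[ z < n ] (𝟙 (full z) + δ v z)                  ≤⟨ ∑-mono-≤ pointwise ⟩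
        ∑[ z < n ] (A G w z * 𝟙 (outside G t z))         ∎
        where
        open ≤-Reasoning
        pointwise : ∀ z → 𝟙 (full z) + δ v z ≤ A G w z * 𝟙 (outside G t z)
        pointwise z with v ≟ z
        ... | yes refl rewrite full-v≡false =
          1≤𝟙*𝟙 (trans (adj-sym G w v) vw) (trans (outside-sym G t v) vt)
        ... | no _ with full z in fz
        ...   | false = z≤n
        ...   | true  = 1≤𝟙*𝟙 (trans (adj-sym G w z) (full⇒adj-w fz))
                              (trans (outside-sym G t z) (full⇒outside-t fz))

      2#full+2≤2k : #full + 1 + 1 + #full ≤ 2 * k
      2#full+2≤2k = begin
        #full + 1 + 1 + #full
          ≤⟨ +-mono-≤ (+-mono-≤ f-t≥#full+1 f-v≥1) (∑𝟙≤∑𝟙* full f f-full≥1) ⟩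
        f t + f v + ∑[ u < n ] (𝟙 (full u) * f u)
          ≤⟨ ∑-points+subset≤∑ f full (outside⇒≢ G vt ∘ sym) full-t≡false full-v≡false ⟩
        ∑[ u < n ] f u
          ≡⟨ ∑missing≡2k w ⟩
        2 * k ∎
        where
        open ≤-Reasoning
        f : Fin n → ℕ
        f u = A G w u * missing G w u
        f-t≥#full+1 : #full + 1 ≤ f t
        f-t≥#full+1 = ≤-trans #full+1≤missing-wt
          (≤-reflexive (sym (trans (cong (λ b → 𝟙 b * missing G w t) wt) (+-identityʳ _))))
        f-v≥1 : 1 ≤ f v
        f-v≥1 = *-mono-≤ (≤-reflexive (cong 𝟙 (sym (trans (adj-sym G w v) vw))))
                         (subst (0 <_) (missing-sym G regular v w) missing-vw>0)
        f-full≥1 : ∀ u → full u ≡ true → 1 ≤ f u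
        f-full≥1 u fu = *-mono-≤ (≤-reflexive (cong 𝟙 (sym (trans (adj-sym G w u) (full⇒adj-w fu)))))
                                 (outside⇒missing>0 G wt (full⇒outside-t fu))

      r<3k : r < 3 * k
      r<3k = begin-strict
        r              ≤⟨ r≤#full+2k ⟩
        #full + 2 * k  <⟨ +-monoˡ-< (2 * k) #full<k ⟩
        3 * k          ∎
        where
        open ≤-Reasoning
        double-suc : ∀ x → 2 * suc x ≡ x + 1 + 1 + x
        double-suc = solve-∀
        #full<k : #full < k
        #full<k = *-cancelˡ-≤ 2 (≤-trans (≤-reflexive (double-suc #full)) 2#full+2≤2k)

  r<3k : r < 3 * k
  r<3k with w , vw*missing>0 ← ∃-unfull
       with vw , missing-vw>0 ← 𝟙*-pos (adj G v w) vw*missing>0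
       with t , wt*vt>0 ← Unfull.∃-outside vw missing-vw>0
       with wt , vt>0 ← 𝟙*-pos (adj G w t) wt*vt>0
       = Unfull.Outside.r<3k vw missing-vw>0 wt (𝟙>0 vt>0)

theorem5p1 : (r : ℕ) → 1 ≤ r →
    ((c : ℕ) → 2 * c ≤ r ^ 2 → 100 * r ^ 3 ≤ (r ^ 2 ∸ 2 * c) ^ 2 → InSpec r c)
    × ((k : ℕ) → 1 ≤ k → 3 * k ≤ r → ¬ InSpec r (r C 2 ∸ k))
theorem5p1 r r≥1 = large-c-in-spec , near-complete-not-in-spec
  where
  large-c-in-spec : (c : ℕ) → 2 * c ≤ r ^ 2 → 100 * r ^ 3 ≤ (r ^ 2 ∸ 2 * c) ^ 2 → InSpec r c
  large-c-in-spec c 2c≤r² hyp with m , a , b , sum≡c , fits ← greedy-decomposition {c = c} r≥1 2c≤r² hyp =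
    inSpec₂⇒inSpec (subst₂ InSpec₂ (m+[n∸m]≡n fits) (cong (2 *_) sum≡c)
                                    (inSpec₂-sum m a b (r ∸ (m + a + 2 * b))))
  near-complete-not-in-spec : (k : ℕ) → 1 ≤ k → 3 * k ≤ r → ¬ InSpec r (r C 2 ∸ k)
  near-complete-not-in-spec k k≥1 3k≤r (n , G , constant) =
    <⇒≱ (NearlyComplete.r<3k G regular ∑missing≡2k k≥1 zero) 3k≤r
    where
    constant₂ : IsConstant₂ G r (2 * (r C 2 ∸ k))
    constant₂ = isConstant⇒isConstant₂ {G = G} constant
    regular : ∀ v → ∑[ u < suc n ] A G v u ≡ r
    regular = proj₁ constant₂
    k≤rC2 : k ≤ r C 2
    k≤rC2 = ≤-trans (m≤m+n k (2 * k)) (≤-trans 3k≤r (r≤rC2 (≤-trans (*-monoʳ-≤ 3 k≥1) 3k≤r)))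
    ∑missing≡2k : ∀ v → ∑[ u < suc n ] (A G v u * missing G v u) ≡ 2 * k
    ∑missing≡2k = missing-sum-of-deficit G k≤rC2 constant₂
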